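{- For any hypergraph $H$ and any vertex $v\in V(H)$, $b_L(H)-1\le b_L(H\setminus\{v\})\le b_L(H)$.
   Context: A hypergraph $H$ consists of a finite vertex set $V(H)$ and a finite collection $E(H)$ of nonempty subsets of $V(H)$. Lazy burning: a set $B\subseteq V(H)$ is burned initially; in each subsequent round every unburned vertex $v$ for which some hyperedge $h\ni v$ has $h\setminus\{v\}$ entirely burned becomes burned. $B$ is a lazy burning set if eventually all vertices burn; $b_L(H)$ is the minimum size of a lazy burning set. For $U\subseteq V(H)$, $H\setminus U$ is the hypergraph with vertex set $V(H)\setminus U$ and hyperedges $\{h\setminus U: h\in E(H),\ h\setminus U\neq\emptyset\}$. -}

module Defs where

open import Data.Nat using (ℕ; zero; suc; _≤_)
open import Data.Fin using (Fin; punchIn)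
open import Data.Fin.Subset using (Subset; _∈_; _∉_; ∣_∣; Nonempty)
open import Data.Fin.Subset.Properties using (nonempty?)
open import Data.Vec using (tabulate; lookup)
open import Data.List using (List; filter; map)
open import Data.List.Membership.Propositional renaming (_∈_ to _∈ₗ_)
open import Data.List.Relation.Unary.All using (All)
open import Data.List.Relation.Unary.All.Properties using (all-filter)
open import Data.Product using (Σ; ∃; _×_)
open import Data.Sum using (_⊎_)
open import Relation.Binary.PropositionalEquality using (_≡_; _≢_)

record Hypergraph (n : ℕ) : Set where
  constructor hypergraph
  field
    edges    : List (Subset n)
    nonempty : All Nonempty edges
open Hypergraph public

Burned : ∀ {n} → Hypergraph n → Subset n → ℕ → Fin n → Set
Burned {n} H B zero    x = x ∈ B
Burned {n} H B (suc k) x =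
  Burned H B k x ⊎
  (Σ (Subset n) λ h → h ∈ₗ edges H × x ∈ h ×
     (∀ y → y ∈ h → y ≢ x → Burned H B k y))

IsLazyBurningSet : ∀ {n} → Hypergraph n → Subset n → Set
IsLazyBurningSet {n} H B = ∃ λ k → ∀ (x : Fin n) → Burned H B k x

IsLazyBurningNumber : ∀ {n} → Hypergraph n → ℕ → Set
IsLazyBurningNumber {n} H m =
  (Σ (Subset n) λ B → IsLazyBurningSet H B × ∣ B ∣ ≡ m) ×
  (∀ (B : Subset n) → IsLazyBurningSet H B → m ≤ ∣ B ∣)

-- Restriction of a subset of Fin (suc n) to the complement of v, reindexed
-- to Fin n via punchIn v.
restrict : ∀ {n} → Fin (suc n) → Subset (suc n) → Subset n
restrict v h = tabulate (λ i → lookup h (punchIn v i))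

delete : ∀ {n} → Hypergraph (suc n) → Fin (suc n) → Hypergraph n
delete H v = hypergraph
  (filter nonempty? (map (restrict v) (edges H)))
  (all-filter nonempty? (map (restrict v) (edges H)))

module Submission where

open import Defs
open import Data.Nat using (ℕ; suc; zero; _≤_; _∸_; _+_; s≤s)
open import Data.Nat.Properties using (≤-trans; ≤-reflexive; ∸-monoˡ-≤)
open import Data.Fin using (Fin; punchIn; punchOut; _≟_)
open import Data.Fin.Properties using (punchIn-injective; punchIn-punchOut)
open import Data.Fin.Subset using (Subset; inside; outside; ∣_∣) renaming (_∈_ to _∈ₛ_)
open import Data.Fin.Subset.Properties using (nonempty?; ∣p∣≤∣x∷p∣)
open import Data.Vec using (_∷_; insertAt)
open import Data.Vec.Properties
  using (lookup∘tabulate; tabulate∘lookup; insertAt-lookup; insertAt-punchIn; lookup⇒[]=; []=⇒lookup)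
open import Data.List.Membership.Propositional renaming (_∈_ to _∈ₗ_)
open import Data.List.Membership.Propositional.Properties using (∈-filter⁺; ∈-filter⁻; ∈-map⁺; ∈-map⁻)
open import Data.Product using (Σ; _×_; _,_; proj₁)
open import Data.Sum using (inj₁; inj₂)
open import Relation.Nullary using (yes; no)
open import Relation.Binary.PropositionalEquality using (_≡_; _≢_; refl; sym; trans; cong; subst)

-- Deleting v from a burning set of H gives one of H \ {v}, and adding v to a
-- burning set of H \ {v} gives one of H: a hyperedge h \ {v} fires in H \ {v}
-- exactly when h fires in H once v is burned.

punchIn-elim : ∀ {n} {P : Fin (suc n) → Set} (v : Fin (suc n)) →
               P v → (∀ j → P (punchIn v j)) → ∀ x → P x
punchIn-elim {P = P} v Pv Pj x with v ≟ x
... | yes refl = Pv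
... | no v≢x   = subst P (punchIn-punchOut v≢x) (Pj (punchOut v≢x))

∈-restrict⁺ : ∀ {n} (v : Fin (suc n)) {h : Subset (suc n)} j →
              punchIn v j ∈ₛ h → j ∈ₛ restrict v h
∈-restrict⁺ v j p = lookup⇒[]= j _ (trans (lookup∘tabulate _ j) ([]=⇒lookup p))

∈-restrict⁻ : ∀ {n} (v : Fin (suc n)) {h : Subset (suc n)} j →
              j ∈ₛ restrict v h → punchIn v j ∈ₛ h
∈-restrict⁻ v {h} j p = lookup⇒[]= (punchIn v j) h (trans (sym (lookup∘tabulate _ j)) ([]=⇒lookup p))

∣restrict∣≤ : ∀ {n} (v : Fin (suc n)) (B : Subset (suc n)) → ∣ restrict v B ∣ ≤ ∣ B ∣
∣restrict∣≤ Fin.zero (x ∷ B) rewrite tabulate∘lookup B = ∣p∣≤∣x∷p∣ x B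
∣restrict∣≤ {suc n} (Fin.suc v) (inside ∷ B)  = s≤s (∣restrict∣≤ v B)
∣restrict∣≤ {suc n} (Fin.suc v) (outside ∷ B) = ∣restrict∣≤ v B

∣insertAt-inside∣ : ∀ {n} (B : Subset n) (v : Fin (suc n)) → ∣ insertAt B v inside ∣ ≡ suc ∣ B ∣
∣insertAt-inside∣ B             Fin.zero    = refl
∣insertAt-inside∣ (inside ∷ B)  (Fin.suc v) = cong suc (∣insertAt-inside∣ B v)
∣insertAt-inside∣ (outside ∷ B) (Fin.suc v) = ∣insertAt-inside∣ B v

∈-insertAt-inside : ∀ {n} (B : Subset n) (v : Fin (suc n)) → v ∈ₛ insertAt B v inside
∈-insertAt-inside B v = lookup⇒[]= v _ (insertAt-lookup B v inside)

∈-insertAt-punchIn : ∀ {n} (B : Subset n) (v : Fin (suc n)) j →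
                     j ∈ₛ B → punchIn v j ∈ₛ insertAt B v inside
∈-insertAt-punchIn B v j p = lookup⇒[]= (punchIn v j) _ (trans (insertAt-punchIn B v inside j) ([]=⇒lookup p))

restrict-∈-edges : ∀ {n} (H : Hypergraph (suc n)) (v : Fin (suc n)) {h} j →
                   h ∈ₗ edges H → punchIn v j ∈ₛ h → restrict v h ∈ₗ edges (delete H v)
restrict-∈-edges H v j h∈ j∈ = ∈-filter⁺ nonempty? (∈-map⁺ (restrict v) h∈) (j , ∈-restrict⁺ v j j∈)

edges-delete⁻ : ∀ {n} (H : Hypergraph (suc n)) (v : Fin (suc n)) {h′} →
                h′ ∈ₗ edges (delete H v) → Σ (Subset (suc n)) λ h → h ∈ₗ edges H × h′ ≡ restrict v h
edges-delete⁻ H v h′∈ = ∈-map⁻ (restrict v) (proj₁ (∈-filter⁻ nonempty? h′∈))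

module _ {n} (H : Hypergraph (suc n)) (v : Fin (suc n)) where

  Burned-restrict : ∀ B k j → Burned H B k (punchIn v j) → Burned (delete H v) (restrict v B) k j
  Burned-restrict B zero    j p                          = ∈-restrict⁺ v j p
  Burned-restrict B (suc k) j (inj₁ p)                   = inj₁ (Burned-restrict B k j p)
  Burned-restrict B (suc k) j (inj₂ (h , h∈ , j∈ , rest)) =
    inj₂ (restrict v h , restrict-∈-edges H v j h∈ j∈ , ∈-restrict⁺ v j j∈ , rest′)
    where
    rest′ : ∀ i → i ∈ₛ restrict v h → i ≢ j → Burned (delete H v) (restrict v B) k i
    rest′ i i∈ i≢j = Burned-restrict B k i
      (rest (punchIn v i) (∈-restrict⁻ v i i∈) (λ eq → i≢j (punchIn-injective v i j eq)))

  restrict-isLazyBurningSet : ∀ B → IsLazyBurningSet H B → IsLazyBurningSet (delete H v) (restrict v B)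
  restrict-isLazyBurningSet B (k , all) = k , λ j → Burned-restrict B k j (all (punchIn v j))

  module _ (B : Subset n) where

    private
      B⁺ = insertAt B v inside

    Burned-insertAt-pivot : ∀ k → Burned H B⁺ k v
    Burned-insertAt-pivot zero    = ∈-insertAt-inside B v
    Burned-insertAt-pivot (suc k) = inj₁ (Burned-insertAt-pivot k)

    Burned-insertAt : ∀ k j → Burned (delete H v) B k j → Burned H B⁺ k (punchIn v j)
    Burned-insertAt zero    j p        = ∈-insertAt-punchIn B v j p
    Burned-insertAt (suc k) j (inj₁ p) = inj₁ (Burned-insertAt k j p)
    Burned-insertAt (suc k) j (inj₂ (h′ , h′∈ , j∈ , rest))
      with edges-delete⁻ H v h′∈
    ... | h , h∈ , refl = inj₂ (h , h∈ , ∈-restrict⁻ v j j∈ , punchIn-elim v pivot others)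
      where
      P : Fin (suc n) → Set
      P y = y ∈ₛ h → y ≢ punchIn v j → Burned H B⁺ k y

      pivot : P v
      pivot _ _ = Burned-insertAt-pivot k

      others : ∀ i → P (punchIn v i)
      others i i∈ i≢j = Burned-insertAt k i (rest i (∈-restrict⁺ v i i∈) (λ eq → i≢j (cong (punchIn v) eq)))

    insertAt-isLazyBurningSet : IsLazyBurningSet (delete H v) B → IsLazyBurningSet H B⁺
    insertAt-isLazyBurningSet (k , all) =
      k , punchIn-elim v (Burned-insertAt-pivot k) (λ j → Burned-insertAt k j (all j))

lazyBurningNumber-≤ : ∀ {n n′} {H : Hypergraph n} {H′ : Hypergraph n′} {m m′} c →
  IsLazyBurningNumber H m → IsLazyBurningNumber H′ m′ →
  (∀ B → IsLazyBurningSet H B → Σ (Subset n′) λ B′ → IsLazyBurningSet H′ B′ × ∣ B′ ∣ ≤ c + ∣ B ∣) →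
  m′ ≤ c + m
lazyBurningNumber-≤ c ((B , burns , refl) , _) (_ , minimal′) transfer
  with transfer B burns
... | B′ , burns′ , size≤ = ≤-trans (minimal′ B′ burns′) size≤

theorem3p8 : ∀ {n} (H : Hypergraph (suc n)) (v : Fin (suc n)) (m m′ : ℕ) →
    IsLazyBurningNumber H m → IsLazyBurningNumber (delete H v) m′ →
    (m ∸ 1 ≤ m′) × (m′ ≤ m)
theorem3p8 H v m m′ bₗH bₗH∖v = ∸-monoˡ-≤ 1 m≤1+m′ , m′≤m
  where
  m′≤m : m′ ≤ m
  m′≤m = lazyBurningNumber-≤ 0 bₗH bₗH∖v λ B burns →
    restrict v B , restrict-isLazyBurningSet H v B burns , ∣restrict∣≤ v B

  m≤1+m′ : m ≤ 1 + m′
  m≤1+m′ = lazyBurningNumber-≤ 1 bₗH∖v bₗH λ B burns →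
    insertAt B v inside , insertAt-isLazyBurningSet H v B burns ,
    ≤-reflexive (∣insertAt-inside∣ B v)
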